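{- Let $s$ be a string. For every node $v$ of the eertree of $s$ other than the two roots $\mathsf{even}$ and $\mathsf{odd}$, $\mathit{precnt}(s,v)=\mathit{sufcnt}(s,v)$.
   Context: $s[i..j]=s[i]\cdots s[j]$; a palindrome is a string equal to its reverse. For $1\le i\le|s|$, $\mathit{prepal}(s,i)$ is the longest palindromic prefix of $s[i..|s|]$ and $\mathit{sufpal}(s,i)$ is the longest palindromic suffix of $s[1..i]$ (both non-empty). The eertree of $s$ has one node for each distinct non-empty palindromic substring of $s$, plus two roots $\mathsf{even}$ and $\mathsf{odd}$; $\operatorname{str}(v)$ denotes the palindrome of node $v$. Define $\mathit{precnt}(s,v)=|\{1\le i\le|s|: \mathit{prepal}(s,i)=\operatorname{str}(v)\}|$ and $\mathit{sufcnt}(s,v)=|\{1\le i\le|s|: \mathit{sufpal}(s,i)=\operatorname{str}(v)\}|$. -}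

module Defs where

open import Data.Nat using (ℕ; zero; suc; _+_; _∸_)
open import Data.List using (List; []; _∷_; reverse; take; drop; length; _++_; upTo; filter)
open import Data.Product using (Σ; ∃; _×_; _,_)
open import Relation.Binary.PropositionalEquality using (_≡_)
open import Relation.Binary.Definitions using (DecidableEquality)
open import Relation.Nullary using (Dec; yes; no; ¬_)
import Data.List.Properties as LP

module _ {A : Set} (_≟A_ : DecidableEquality A) where

  _≟L_ : DecidableEquality (List A)
  _≟L_ = LP.≡-dec _≟A_

  IsPalindrome : List A → Set
  IsPalindrome w = reverse w ≡ w

  isPal? : (w : List A) → Dec (IsPalindrome w)
  isPal? w = reverse w ≟L w

  IsSubstring : List A → List A → Set
  IsSubstring w s = Σ (List A) λ u → Σ (List A) λ v → s ≡ u ++ w ++ v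

  lppUpTo : ℕ → List A → List A
  lppUpTo zero xs = []
  lppUpTo (suc k) xs with isPal? (take (suc k) xs)
  ... | yes _ = take (suc k) xs
  ... | no  _ = lppUpTo k xs

  longestPalPrefix : List A → List A
  longestPalPrefix xs = lppUpTo (length xs) xs

  lpsUpTo : ℕ → List A → List A
  lpsUpTo zero xs = []
  lpsUpTo (suc k) xs with isPal? (drop (length xs ∸ suc k) xs)
  ... | yes _ = drop (length xs ∸ suc k) xs
  ... | no  _ = lpsUpTo k xs

  longestPalSuffix : List A → List A
  longestPalSuffix xs = lpsUpTo (length xs) xs

  -- 0-indexed: position j ∈ [0,|s|) corresponds to paper's i = j+1.
  -- prepal(s, j+1) = longest palindromic prefix of s[j+1..|s|] = drop j s
  prepal : List A → ℕ → List A
  prepal s j = longestPalPrefix (drop j s)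

  -- sufpal(s, j+1) = longest palindromic suffix of s[1..j+1] = take (suc j) s
  sufpal : List A → ℕ → List A
  sufpal s j = longestPalSuffix (take (suc j) s)

  precnt : List A → List A → ℕ
  precnt s w = length (filter (λ j → prepal s j ≟L w) (upTo (length s)))

  sufcnt : List A → List A → ℕ
  sufcnt s w = length (filter (λ j → sufpal s j ≟L w) (upTo (length s)))

-- The lists (prepal s i)ᵢ and (sufpal s i)ᵢ are permutations of each other, which we
-- show by appending letters to s one at a time. Appending c to x adds exactly one
-- suffix value, lps(xc). On the prefix side we induct from the front of x = a y: the
-- value at the first position changes from lpp(ay) to lpp(ayc) only if ayc is a
-- palindrome, and then lpp(ayc) = lps(ayc) while the mirror symmetry of ayc turns
-- lps(yc) into lpp(ay); so the multiset {lpp(ayc), lps(yc)} equals {lpp(ay), lps(ayc)}.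
module Submission where

open import Defs
open import Data.List using (List; []; _∷_; [_]; reverse; take; drop; length; _++_; _∷ʳ_; map; filter; upTo; applyUpTo)
import Data.List.Properties as List
open import Data.List.Reverse using (Reverse; []; _∶_∶ʳ_; reverseView)
open import Data.List.Relation.Binary.Permutation.Propositional using (_↭_; prep; swap; ↭-refl; ↭-reflexive; ↭ₛ⇒↭; ↭⇒↭ₛ; module PermutationReasoning)
open import Data.List.Relation.Binary.Permutation.Propositional.Properties using (∷↭∷ʳ; ++⁺ʳ; ↭-length)
import Data.List.Relation.Binary.Permutation.Setoid.Properties as SetoidPermutation
open import Data.Nat using (ℕ; zero; suc; _∸_; _≤_; _<_; z≤n; s≤s)
open import Data.Nat.Properties using (+-comm; m∸[m∸n]≡n; ≤-refl; ≤-reflexive; ≤-trans; n≤1+n)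
open import Function using (_∘_)
open import Level using (Level)
open import Relation.Binary.Definitions using (DecidableEquality)
open import Relation.Binary.PropositionalEquality using (_≡_; refl; sym; trans; cong; cong₂; subst; setoid; module ≡-Reasoning)
open import Relation.Nullary using (¬_; yes; no; contradiction)
open import Relation.Unary using (Pred; Decidable)

private
  variable
    a b p : Level
    B : Set a
    C : Set b

take-++ˡ : ∀ j (xs ys : List B) → j ≤ length xs → take j (xs ++ ys) ≡ take j xs
take-++ˡ zero    xs       ys _         = refl
take-++ˡ (suc j) (x ∷ xs) ys (s≤s j≤n) = cong (x ∷_) (take-++ˡ j xs ys j≤n)

length-∷ʳ : ∀ (xs : List B) x → length (xs ∷ʳ x) ≡ suc (length xs)
length-∷ʳ xs x = trans (List.length-++ xs) (+-comm (length xs) 1)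

drop-∸≡reverse-take-reverse : ∀ j (xs : List B) → j ≤ length xs →
  drop (length xs ∸ j) xs ≡ reverse (take j (reverse xs))
drop-∸≡reverse-take-reverse {B = B} j xs j≤n = begin
  D                                     ≡⟨ List.reverse-involutive D ⟨
  reverse (reverse D)                   ≡⟨ cong reverse (List.take-all j (reverse D) (≤-reflexive |rD|≡j)) ⟨
  reverse (take j (reverse D))          ≡⟨ cong reverse (take-++ˡ j (reverse D) (reverse T) (≤-reflexive (sym |rD|≡j))) ⟨
  reverse (take j (reverse D ++ reverse T)) ≡⟨ cong (reverse ∘ take j) (List.reverse-++ T D) ⟨
  reverse (take j (reverse (T ++ D)))   ≡⟨ cong (reverse ∘ take j ∘ reverse) (List.take++drop≡id m xs) ⟩
  reverse (take j (reverse xs))         ∎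
  where
  open ≡-Reasoning
  m : ℕ
  m = length xs ∸ j
  D T : List B
  D = drop m xs
  T = take m xs
  |rD|≡j : length (reverse D) ≡ j
  |rD|≡j = trans (List.length-reverse D) (trans (List.length-drop m xs) (m∸[m∸n]≡n j≤n))

applyUpTo-cong : ∀ {f g : ℕ → B} n → (∀ j → j < n → f j ≡ g j) → applyUpTo f n ≡ applyUpTo g n
applyUpTo-cong zero    f≡g = refl
applyUpTo-cong (suc n) f≡g =
  cong₂ _∷_ (f≡g 0 (s≤s z≤n)) (applyUpTo-cong n (λ j j<n → f≡g (suc j) (s≤s j<n)))

map-filter : {P : Pred C p} (P? : Decidable P) (f : B → C) (xs : List B) →
  map f (filter (P? ∘ f) xs) ≡ filter P? (map f xs)
map-filter P? f []       = refl
map-filter P? f (x ∷ xs) with P? (f x)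
... | yes _ = cong (f x ∷_) (map-filter P? f xs)
... | no  _ = map-filter P? f xs

↭⇒length-filter≡ : {P : Pred B p} (P? : Decidable P) {xs ys : List B} → xs ↭ ys →
  length (filter P? xs) ≡ length (filter P? ys)
↭⇒length-filter≡ P? xs↭ys =
  ↭-length (↭ₛ⇒↭ (SetoidPermutation.filter⁺ (setoid _) P? (subst _) (↭⇒↭ₛ xs↭ys)))

∷-∷ʳ-↭ : ∀ {x y x′ y′ : B} xs → x ∷ [ y ] ↭ x′ ∷ [ y′ ] → x ∷ xs ∷ʳ y ↭ x′ ∷ xs ∷ʳ y′
∷-∷ʳ-↭ {x = x} {y} {x′} {y′} xs pair↭ = begin
  x ∷ xs ∷ʳ y        ↭⟨ prep x (∷↭∷ʳ y xs) ⟨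
  (x ∷ [ y ]) ++ xs   ↭⟨ ++⁺ʳ xs pair↭ ⟩
  (x′ ∷ [ y′ ]) ++ xs ↭⟨ prep x′ (∷↭∷ʳ y′ xs) ⟩
  x′ ∷ xs ∷ʳ y′      ∎
  where open PermutationReasoning

module _ {A : Set} (_≟A_ : DecidableEquality A) where

  private
    _≟_ : DecidableEquality (List A)
    _≟_ = _≟L_ _≟A_
    Palindrome : List A → Set
    Palindrome = IsPalindrome _≟A_
    lppUpTo′ lpsUpTo′ : ℕ → List A → List A
    lppUpTo′ = lppUpTo _≟A_
    lpsUpTo′ = lpsUpTo _≟A_
    lpp lps : List A → List A
    lpp = longestPalPrefix _≟A_
    lps = longestPalSuffix _≟A_

  palindrome-reverse : ∀ w → Palindrome w → Palindrome (reverse w)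
  palindrome-reverse w = cong reverse

  palindrome-reverse⁻¹ : ∀ w → Palindrome (reverse w) → Palindrome w
  palindrome-reverse⁻¹ w pal = trans (sym pal) (List.reverse-involutive w)

  lppUpTo-palindrome : ∀ k xs → Palindrome (lppUpTo′ k xs)
  lppUpTo-palindrome zero    xs = refl
  lppUpTo-palindrome (suc k) xs with isPal? _≟A_ (take (suc k) xs)
  ... | yes pal = pal
  ... | no  _   = lppUpTo-palindrome k xs

  lppUpTo-take : ∀ k xs → Palindrome (take k xs) → lppUpTo′ k xs ≡ take k xs
  lppUpTo-take zero    xs _   = refl
  lppUpTo-take (suc k) xs pal with isPal? _≟A_ (take (suc k) xs)
  ... | yes _   = refl
  ... | no ¬pal = contradiction pal ¬pal

  lppUpTo-suc-nonPalindrome : ∀ k xs → ¬ Palindrome (take (suc k) xs) →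
    lppUpTo′ (suc k) xs ≡ lppUpTo′ k xs
  lppUpTo-suc-nonPalindrome k xs ¬pal with isPal? _≟A_ (take (suc k) xs)
  ... | yes pal = contradiction pal ¬pal
  ... | no  _   = refl

  lppUpTo-cong : ∀ k {xs ys} → (∀ j → j ≤ k → take j xs ≡ take j ys) →
    lppUpTo′ k xs ≡ lppUpTo′ k ys
  lppUpTo-cong zero    same = refl
  lppUpTo-cong (suc k) {xs} {ys} same with isPal? _≟A_ (take (suc k) xs)
  ... | yes pal = trans (same (suc k) ≤-refl)
                        (sym (lppUpTo-take (suc k) ys (subst Palindrome (same (suc k) ≤-refl) pal)))
  ... | no ¬pal = trans (lppUpTo-cong k (λ j j≤k → same j (≤-trans j≤k (n≤1+n k))))
                        (sym (lppUpTo-suc-nonPalindrome k ys (¬pal ∘ subst Palindrome (sym (same (suc k) ≤-refl)))))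

  lpsUpTo≡reverse-lppUpTo-reverse : ∀ k ys → k ≤ length ys →
    lpsUpTo′ k ys ≡ reverse (lppUpTo′ k (reverse ys))
  lpsUpTo≡reverse-lppUpTo-reverse zero    ys _   = refl
  lpsUpTo≡reverse-lppUpTo-reverse (suc k) ys k<n with isPal? _≟A_ (drop (length ys ∸ suc k) ys)
  ... | yes pal = trans suffix≡ (cong reverse (sym (lppUpTo-take (suc k) (reverse ys)
                    (palindrome-reverse⁻¹ _ (subst Palindrome suffix≡ pal)))))
    where
    suffix≡ : drop (length ys ∸ suc k) ys ≡ reverse (take (suc k) (reverse ys))
    suffix≡ = drop-∸≡reverse-take-reverse (suc k) ys k<n
  ... | no ¬pal = trans (lpsUpTo≡reverse-lppUpTo-reverse k ys (≤-trans (n≤1+n k) k<n))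
                        (cong reverse (sym (lppUpTo-suc-nonPalindrome k (reverse ys) ¬pal′)))
    where
    ¬pal′ : ¬ Palindrome (take (suc k) (reverse ys))
    ¬pal′ pal = ¬pal (subst Palindrome (sym (drop-∸≡reverse-take-reverse (suc k) ys k<n))
                                       (palindrome-reverse _ pal))

  lps≡reverse-lpp-reverse : ∀ ys → lps ys ≡ reverse (lpp (reverse ys))
  lps≡reverse-lpp-reverse ys =
    trans (lpsUpTo≡reverse-lppUpTo-reverse (length ys) ys ≤-refl)
          (cong (λ n → reverse (lppUpTo′ n (reverse ys))) (sym (List.length-reverse ys)))

  lpp-palindrome : ∀ w → Palindrome (lpp w)
  lpp-palindrome w = lppUpTo-palindrome (length w) w

  palindrome⇒lpp≡id : ∀ w → Palindrome w → lpp w ≡ w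
  palindrome⇒lpp≡id w pal = trans (lppUpTo-take (length w) w (subst Palindrome (sym take-all) pal)) take-all
    where
    take-all : take (length w) w ≡ w
    take-all = List.take-all (length w) w ≤-refl

  palindrome⇒lps≡id : ∀ w → Palindrome w → lps w ≡ w
  palindrome⇒lps≡id w pal = begin
    lps w                      ≡⟨ lps≡reverse-lpp-reverse w ⟩
    reverse (lpp (reverse w))  ≡⟨ cong (reverse ∘ lpp) pal ⟩
    reverse (lpp w)            ≡⟨ cong reverse (palindrome⇒lpp≡id w pal) ⟩
    reverse w                  ≡⟨ pal ⟩
    w                          ∎
    where open ≡-Reasoning

  lpp-∷ʳ-nonPalindrome : ∀ xs c → ¬ Palindrome (xs ∷ʳ c) → lpp (xs ∷ʳ c) ≡ lpp xs
  lpp-∷ʳ-nonPalindrome xs c ¬pal = begin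
    lppUpTo′ (length (xs ∷ʳ c)) (xs ∷ʳ c) ≡⟨ cong (λ n → lppUpTo′ n (xs ∷ʳ c)) (length-∷ʳ xs c) ⟩
    lppUpTo′ (suc (length xs)) (xs ∷ʳ c)  ≡⟨ lppUpTo-suc-nonPalindrome (length xs) (xs ∷ʳ c) (¬pal ∘ subst Palindrome take-all) ⟩
    lppUpTo′ (length xs) (xs ∷ʳ c)        ≡⟨ lppUpTo-cong (length xs) (λ j j≤n → take-++ˡ j xs [ c ] j≤n) ⟩
    lppUpTo′ (length xs) xs               ∎
    where
    open ≡-Reasoning
    take-all : take (suc (length xs)) (xs ∷ʳ c) ≡ xs ∷ʳ c
    take-all = List.take-all (suc (length xs)) (xs ∷ʳ c) (≤-reflexive (length-∷ʳ xs c))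

  lps-∷-nonPalindrome : ∀ x ys → ¬ Palindrome (x ∷ ys) → lps (x ∷ ys) ≡ lps ys
  lps-∷-nonPalindrome x ys ¬pal = begin
    lps (x ∷ ys)                        ≡⟨ lps≡reverse-lpp-reverse (x ∷ ys) ⟩
    reverse (lpp (reverse (x ∷ ys)))    ≡⟨ cong (reverse ∘ lpp) (List.unfold-reverse x ys) ⟩
    reverse (lpp (reverse ys ∷ʳ x))     ≡⟨ cong reverse (lpp-∷ʳ-nonPalindrome (reverse ys) x ¬pal′) ⟩
    reverse (lpp (reverse ys))          ≡⟨ lps≡reverse-lpp-reverse ys ⟨
    lps ys                              ∎
    where
    open ≡-Reasoning
    ¬pal′ : ¬ Palindrome (reverse ys ∷ʳ x)
    ¬pal′ pal = ¬pal (palindrome-reverse⁻¹ (x ∷ ys) (subst Palindrome (sym (List.unfold-reverse x ys)) pal))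

  palindrome⇒lps-tail≡lpp-init : ∀ x ys c → Palindrome (x ∷ ys ∷ʳ c) → lps (ys ∷ʳ c) ≡ lpp (x ∷ ys)
  palindrome⇒lps-tail≡lpp-init x ys c pal = begin
    lps (ys ∷ʳ c)                    ≡⟨ lps≡reverse-lpp-reverse (ys ∷ʳ c) ⟩
    reverse (lpp (reverse (ys ∷ʳ c))) ≡⟨ cong (reverse ∘ lpp) mirror ⟩
    reverse (lpp (x ∷ ys))           ≡⟨ lpp-palindrome (x ∷ ys) ⟩
    lpp (x ∷ ys)                     ∎
    where
    open ≡-Reasoning
    mirror : reverse (ys ∷ʳ c) ≡ x ∷ ys
    mirror = List.∷ʳ-injectiveˡ _ (x ∷ ys) (trans (sym (List.unfold-reverse x (ys ∷ʳ c))) pal)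

  lpp-lps-exchange : ∀ x ys c →
    lpp (x ∷ ys ∷ʳ c) ∷ [ lps (ys ∷ʳ c) ] ↭ lpp (x ∷ ys) ∷ [ lps (x ∷ ys ∷ʳ c) ]
  lpp-lps-exchange x ys c with isPal? _≟A_ (x ∷ ys ∷ʳ c)
  ... | yes pal = begin
    lpp w ∷ [ lps (ys ∷ʳ c) ]    ≡⟨ cong₂ (λ u v → u ∷ [ v ]) (trans (palindrome⇒lpp≡id w pal) (sym (palindrome⇒lps≡id w pal)))
                                                          (palindrome⇒lps-tail≡lpp-init x ys c pal) ⟩
    lps w ∷ [ lpp (x ∷ ys) ]     ↭⟨ swap _ _ ↭-refl ⟩
    lpp (x ∷ ys) ∷ [ lps w ]     ∎
    where
    open PermutationReasoning
    w : List A
    w = x ∷ ys ∷ʳ c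
  ... | no ¬pal = ↭-reflexive (cong₂ (λ u v → u ∷ [ v ]) (lpp-∷ʳ-nonPalindrome (x ∷ ys) c ¬pal)
                                                     (sym (lps-∷-nonPalindrome x (ys ∷ʳ c) ¬pal)))

  prefixPalindromes suffixPalindromes : List A → List (List A)
  prefixPalindromes s = applyUpTo (prepal _≟A_ s) (length s)
  suffixPalindromes s = applyUpTo (sufpal _≟A_ s) (length s)

  suffixPalindromes-∷ʳ : ∀ xs c → suffixPalindromes (xs ∷ʳ c) ≡ suffixPalindromes xs ∷ʳ lps (xs ∷ʳ c)
  suffixPalindromes-∷ʳ xs c = begin
    applyUpTo (sufpal _≟A_ (xs ∷ʳ c)) (length (xs ∷ʳ c))          ≡⟨ cong (applyUpTo _) (length-∷ʳ xs c) ⟩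
    applyUpTo (sufpal _≟A_ (xs ∷ʳ c)) (suc (length xs))           ≡⟨ List.applyUpTo-∷ʳ _ (length xs) ⟨
    applyUpTo (sufpal _≟A_ (xs ∷ʳ c)) (length xs) ∷ʳ lps (take (suc (length xs)) (xs ∷ʳ c))
      ≡⟨ cong₂ _∷ʳ_ (applyUpTo-cong (length xs) (λ j j<n → cong lps (take-++ˡ (suc j) xs [ c ] j<n)))
                    (cong lps (List.take-all _ (xs ∷ʳ c) (≤-reflexive (length-∷ʳ xs c)))) ⟩
    suffixPalindromes xs ∷ʳ lps (xs ∷ʳ c)                          ∎
    where open ≡-Reasoning

  prefixPalindromes-∷ʳ : ∀ xs c → prefixPalindromes (xs ∷ʳ c) ↭ prefixPalindromes xs ∷ʳ lps (xs ∷ʳ c)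
  prefixPalindromes-∷ʳ []       c = ↭-reflexive (cong [_] (trans (palindrome⇒lpp≡id [ c ] refl)
                                                                  (sym (palindrome⇒lps≡id [ c ] refl))))
  prefixPalindromes-∷ʳ (x ∷ ys) c = begin
    lpp (x ∷ ys ∷ʳ c) ∷ prefixPalindromes (ys ∷ʳ c)             ↭⟨ prep _ (prefixPalindromes-∷ʳ ys c) ⟩
    lpp (x ∷ ys ∷ʳ c) ∷ prefixPalindromes ys ∷ʳ lps (ys ∷ʳ c)   ↭⟨ ∷-∷ʳ-↭ (prefixPalindromes ys) (lpp-lps-exchange x ys c) ⟩
    lpp (x ∷ ys) ∷ prefixPalindromes ys ∷ʳ lps (x ∷ ys ∷ʳ c)    ∎
    where open PermutationReasoning

  prefixPalindromes↭suffixPalindromes : ∀ {s} → Reverse s → prefixPalindromes s ↭ suffixPalindromes s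
  prefixPalindromes↭suffixPalindromes []              = ↭-refl
  prefixPalindromes↭suffixPalindromes (xs ∶ r ∶ʳ c) = begin
    prefixPalindromes (xs ∷ʳ c)                  ↭⟨ prefixPalindromes-∷ʳ xs c ⟩
    prefixPalindromes xs ∷ʳ lps (xs ∷ʳ c)        ↭⟨ ++⁺ʳ _ (prefixPalindromes↭suffixPalindromes r) ⟩
    suffixPalindromes xs ∷ʳ lps (xs ∷ʳ c)        ≡⟨ suffixPalindromes-∷ʳ xs c ⟨
    suffixPalindromes (xs ∷ʳ c)                  ∎
    where open PermutationReasoning

  occurrences : List A → List (List A) → ℕ
  occurrences v ws = length (filter (_≟ v) ws)

  length-filter-upTo : ∀ v (f : ℕ → List A) n →
    length (filter (λ j → f j ≟ v) (upTo n)) ≡ occurrences v (applyUpTo f n)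
  length-filter-upTo v f n = begin
    length (filter ((_≟ v) ∘ f) (upTo n))          ≡⟨ List.length-map f (filter ((_≟ v) ∘ f) (upTo n)) ⟨
    length (map f (filter ((_≟ v) ∘ f) (upTo n)))  ≡⟨ cong length (map-filter (_≟ v) f (upTo n)) ⟩
    length (filter (_≟ v) (map f (upTo n)))        ≡⟨ cong (occurrences v) (List.map-upTo f n) ⟩
    occurrences v (applyUpTo f n)                  ∎
    where open ≡-Reasoning

  precnt≡sufcnt : ∀ s v → precnt _≟A_ s v ≡ sufcnt _≟A_ s v
  precnt≡sufcnt s v = begin
    precnt _≟A_ s v                      ≡⟨ length-filter-upTo v (prepal _≟A_ s) (length s) ⟩
    occurrences v (prefixPalindromes s)  ≡⟨ ↭⇒length-filter≡ (_≟ v) (prefixPalindromes↭suffixPalindromes (reverseView s)) ⟩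
    occurrences v (suffixPalindromes s)  ≡⟨ length-filter-upTo v (sufpal _≟A_ s) (length s) ⟨
    sufcnt _≟A_ s v                      ∎
    where open ≡-Reasoning

-- The identity holds for every string v.
lemma17 : {A : Set} (_≟A_ : DecidableEquality A) (s v : List A) →
    ¬ (v ≡ []) → IsPalindrome _≟A_ v → IsSubstring _≟A_ v s →
    precnt _≟A_ s v ≡ sufcnt _≟A_ s v
lemma17 _≟A_ s v _ _ _ = precnt≡sufcnt _≟A_ s v
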